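{- Let $A$ and $B$ be automata and let $(b,n)$ be a normed backward simulation from $A$ to $B$. (1) For every finite execution $\alpha$ of $A$ there is a finite execution $\alpha'$ of $B$ such that $\alpha$ and $\alpha'$ correspond via $b$. (2) If moreover $b$ is image-finite (i.e., $b[s]$ is finite for every state $s$ of $A$), then for every execution $\alpha$ of $A$ there is an execution $\alpha'$ of $B$ such that $\alpha$ and $\alpha'$ correspond via $b$.
   Context: An automaton $A$ consists of a set $\mathit{states}(A)$, a nonempty set $\mathit{start}(A)\subseteq\mathit{states}(A)$, a set $\mathit{acts}(A)$ of actions containing a distinguished internal action $\tau$, and $\mathit{steps}(A)\subseteq \mathit{states}(A)\times\mathit{acts}(A)\times\mathit{states}(A)$; write $s\xrightarrow{a}_A t$. An execution fragment is a finite or infinite alternating sequence $s_0a_1s_1\cdots$ starting with a state (ending with a state if finite) with $s_{i-1}\xrightarrow{a_i}_A s_i$; an execution starts in a start state. Write $b[s]=\{u\mid(s,u)\in b\}$. A normed backward simulation from $A$ to $B$ is a pair $(b,n)$ with $b\subseteq\mathit{states}(A)\times\mathit{states}(B)$ total (every state of $A$ is related to at least one state of $B$) and $n:(\mathit{steps}(A)\cup\mathit{start}(A))\times\mathit{states}(B)\to S$ for a well-founded ordered set $(S,<)$, such that (1) if $s\in\mathit{start}(A)$ and $u\in b[s]$ then (a) $u\in\mathit{start}(B)$, or (b) $\exists v\in b[s]: v\xrightarrow{\tau}_B u$ and $n(s,v)<n(s,u)$; (2) if $t\xrightarrow{a}_A s$ and $u\in b[s]$ then (a) $u\in b[t]$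 and $a=\tau$, or (b) $\exists v\in b[t]: v\xrightarrow{a}_B u$, or (c) $\exists v\in b[s]: v\xrightarrow{\tau}_B u$ and $n(t\xrightarrow{a}s,v)<n(t\xrightarrow{a}s,u)$. Correspondence: for $R\subseteq\mathit{states}(A)\times\mathit{states}(B)$ and execution fragments $\alpha=s_0a_1s_1\cdots$ of $A$, $\alpha'=u_0b_1u_1\cdots$ of $B$ with state index sets $\mathrm{Ind}(\alpha),\mathrm{Ind}(\alpha')$, they correspond via $R$ if there is $I\subseteq\mathrm{Ind}(\alpha)\times\mathrm{Ind}(\alpha')$ with: (1) $(i,j)\in I\Rightarrow(s_i,u_j)\in R$; (2) $(i,j),(i',j')\in I$, $i<i'\Rightarrow j\le j'$; (3) $I$ and $I^{ -1}$ total; (4) $(i,j),(i+1,j+1)\in I\Rightarrow a_{i+1}=b_{j+1}$; $(i,j),(i+1,j)\in I\Rightarrow a_{i+1}=\tau$; $(i,j),(i,j+1)\in I\Rightarrow b_{j+1}=\tau$. -}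

module Defs where

open import Level using (0ℓ)
open import Data.Nat using (ℕ; zero; suc; _≤_; _<_)
open import Data.Unit using (⊤)
open import Data.Product using (Σ; ∃; ∃-syntax; _×_; _,_)
open import Data.Sum using (_⊎_)
open import Data.List using (List)
open import Data.List.Membership.Propositional using (_∈_)
open import Function.Bundles using (_⇔_)
open import Relation.Binary.PropositionalEquality using (_≡_)
open import Relation.Binary.Definitions using (Transitive)
open import Induction.WellFounded using (WellFounded)

-- All automata considered draw their actions from a common universe `Act`
-- containing the distinguished internal action τ (so that actions of A and
-- of B can be compared, as in clause (4) of correspondence).
record Automaton (Act : Set) (τ : Act) : Set₁ where
  field
    State    : Set
    Start    : State → Set
    start≠∅  : ∃[ s ] Start s
    acts     : Act → Set
    τ∈acts   : acts τ
    Step     : State → Act → State → Set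
    step-act : ∀ {s a t} → Step s a t → acts a

-- Length of an execution fragment: finite with last state index n, or infinite.
data Len : Set where
  fin : ℕ → Len
  inf : Len

InInd : Len → ℕ → Set
InInd (fin n) i = i ≤ n
InInd inf     i = ⊤

module _ {Act : Set} {τ : Act} (A : Automaton Act τ) where
  open Automaton A

  -- Execution fragment s₀ a₁ s₁ a₂ s₂ ⋯ : state i is `st i`, action a_{i+1}
  -- is `act i`; values outside the index set are irrelevant.
  record ExecFrag : Set where
    field
      len  : Len
      st   : ℕ → State
      act  : ℕ → Act
      step : ∀ i → InInd len (suc i) → Step (st i) (act i) (st (suc i))

  record Execution : Set where
    field
      frag  : ExecFrag
      start : Start (ExecFrag.st frag 0)
    open ExecFrag frag public

  IsFinite : Execution → Set
  IsFinite α = ∃[ n ] (Execution.len α ≡ fin n)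

module _ {Act : Set} {τ : Act} {A B : Automaton Act τ} where
  private
    module A = Automaton A
    module B = Automaton B

  Corresponds : (A.State → B.State → Set) → Execution A → Execution B → Set₁
  Corresponds R α α' =
    Σ (ℕ → ℕ → Set) λ I →
      (∀ {i j} → I i j → InInd α.len i × InInd α'.len j)
    × (∀ {i j} → I i j → R (α.st i) (α'.st j))
    × (∀ {i j i' j'} → I i j → I i' j' → i < i' → j ≤ j')
    × (∀ i → InInd α.len i → ∃[ j ] I i j)
    × (∀ j → InInd α'.len j → ∃[ i ] I i j)
    × (∀ {i j} → I i j → I (suc i) (suc j) → α.act i ≡ α'.act j)
    × (∀ {i j} → I i j → I (suc i) j → α.act i ≡ τ)
    × (∀ {i j} → I i j → I i (suc j) → α'.act j ≡ τ)
    where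
      module α  = Execution α
      module α' = Execution α'

  -- Normed backward simulation (b , n) from A to B, with n valued in a
  -- well-founded ordered set (S , _<ˢ_).  The norm n on
  -- (steps(A) ∪ start(A)) × states(B) is given as two functions.
  record IsNormedBackwardSim
      (b : A.State → B.State → Set)
      (S : Set) (_<ˢ_ : S → S → Set)
      (nStart : ∀ {s} → A.Start s → B.State → S)
      (nStep  : ∀ {t a s} → A.Step t a s → B.State → S) : Set where
    field
      total : ∀ s → ∃[ u ] b s u
      start-cond : ∀ {s} (p : A.Start s) {u} → b s u →
        B.Start u
        ⊎ (∃[ v ] (b s v × B.Step v τ u × (nStart p v <ˢ nStart p u)))
      step-cond : ∀ {t a s} (p : A.Step t a s) {u} → b s u →
        (b t u × a ≡ τ)
        ⊎ (∃[ v ] (b t v × B.Step v a u))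
        ⊎ (∃[ v ] (b s v × B.Step v τ u × (nStep p v <ˢ nStep p u)))

  ImageFinite : (A.State → B.State → Set) → Set
  ImageFinite b = ∀ s → ∃[ l ] (∀ u → b s u ⇔ (u ∈ l))

-- Walking backwards through a finite execution of A, every B-state related to s_{i+1} is reached from some
-- B-state related to s_i by a segment: a τ-chain inside b[s_{i+1}], preceded by a step labelled a_{i+1} or,
-- when a_{i+1} = τ, by nothing. The norm strictly decreases along every τ-step the simulation conditions
-- supply, so well-founded recursion makes each chain finite, and at s₀ it starts in a start state of B.
-- For an infinite execution, image-finiteness and (classically) König's lemma select one infinite sequence
-- of such segments. Replayed forwards, the segments form a lockstep path through pairs (i , j) of positions
-- in which every step advances A, B or both; removing B's stuttering yields the execution α', and the
-- visited pairs are the correspondence.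

module Submission where

open import Defs
open import Level using (lift; lower)
open import Data.Empty using (⊥-elim)
open import Data.Unit using (⊤; tt)
open import Data.Nat using (ℕ; _+_; _∸_; _≤_; _<_; z≤n; s≤s; _≤?_; _≟_; _⊔_)
open import Data.Nat.Properties
  using (≤-refl; ≤-reflexive; ≤-trans; ≤-antisym; ≤-total; ≤-pred; <⇒≤; <⇒≱; ≰⇒>; ≤∧≢⇒<; <-cmp;
         n≤1+n; 1+n≰n; 1+n≢n; m≤n⇒m<n∨m≡n; suc-injective; n≤0⇒n≡0;
         m≤n+m; m≤m⊔n; m≤n⊔m; m∸n+n≡m; +-suc)
open import Data.Product using (Σ; ∃-syntax; _×_; _,_; proj₁; proj₂)
open import Data.Sum using (_⊎_; inj₁; inj₂; assocˡ)
open import Data.List using (List; []; _∷_)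
open import Data.List.Membership.Propositional using (_∈_)
open import Data.List.Relation.Unary.Any using (here; there)
open import Function using (_∘_)
open import Function.Bundles using (Equivalence)
open import Relation.Binary using (tri<; tri≈; tri>)
open import Relation.Binary.Definitions using (Transitive)
open import Relation.Binary.PropositionalEquality using (_≡_; refl; sym; trans; cong; subst; subst₂)
open import Relation.Binary.Construct.Closure.ReflexiveTransitive using (Star; ε; _◅_; _◅◅_)
open import Relation.Nullary using (¬_; Dec; yes; no)
open import Relation.Nullary.Decidable using (map′)
open import Induction.WellFounded using (WellFounded; Acc; acc)
open import Axiom.ExcludedMiddle using (ExcludedMiddle)
import Level

module Classical where
  EM : Set₂
  EM = ExcludedMiddle (Level.suc Level.zero)

  decide : EM → (P : Set) → Dec P
  decide em P = map′ lower lift em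

  ¬¬-elim : EM → {P : Set} → ¬ ¬ P → P
  ¬¬-elim em {P} ¬¬p with decide em P
  ... | yes p = p
  ... | no ¬p = ⊥-elim (¬¬p ¬p)

  -- The combinatorial core of König's lemma.
  ∀∃∈⇒∃∈∀ : EM → {X : Set} (Q : ℕ → X → Set) → (∀ {m n x} → n ≤ m → Q m x → Q n x) →
            (l : List X) → (∀ m → ∃[ x ] (x ∈ l × Q m x)) → ∃[ x ] (x ∈ l × ∀ m → Q m x)
  ∀∃∈⇒∃∈∀ em Q antitone [] some with some 0
  ... | _ , () , _
  ∀∃∈⇒∃∈∀ em Q antitone (y ∷ ys) some with decide em (∃[ m₀ ] ¬ Q m₀ y)
  ... | no never = y , here refl , λ m → ¬¬-elim em (λ ¬q → never (m , ¬q))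
  ... | yes (m₀ , ¬q) =
    let x , x∈ys , q = ∀∃∈⇒∃∈∀ em Q antitone ys someInTail in x , there x∈ys , q
    where
    someInTail : ∀ m → ∃[ x ] (x ∈ ys × Q m x)
    someInTail m with some (m ⊔ m₀)
    ... | _ , here refl , q = ⊥-elim (¬q (antitone (m≤n⊔m m m₀) q))
    ... | x , there x∈ys , q = x , x∈ys , antitone (m≤m⊔n m m₀) q

module Sequences where
  open import Data.Nat using (zero; suc)
  open Classical using (EM; decide; ¬¬-elim)

  UnitStep : (ℕ → ℕ) → Set
  UnitStep f = ∀ p → f (suc p) ≡ f p ⊎ f (suc p) ≡ suc (f p)

  module UnitStep {f : ℕ → ℕ} (unit : UnitStep f) where

    f≤f-suc : ∀ p → f p ≤ f (suc p)
    f≤f-suc p with unit p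
    ... | inj₁ eq = subst (f p ≤_) (sym eq) ≤-refl
    ... | inj₂ eq = subst (f p ≤_) (sym eq) (n≤1+n (f p))

    f-suc≤1+f : ∀ p → f (suc p) ≤ suc (f p)
    f-suc≤1+f p with unit p
    ... | inj₁ eq = subst (_≤ suc (f p)) (sym eq) (n≤1+n (f p))
    ... | inj₂ eq = subst (_≤ suc (f p)) (sym eq) ≤-refl

    monotone : ∀ {p q} → p ≤ q → f p ≤ f q
    monotone {p} {q} p≤q = subst (λ r → f p ≤ f r) (m∸n+n≡m p≤q) (grow (q ∸ p))
      where
      grow : ∀ d → f p ≤ f (d + p)
      grow zero    = ≤-refl
      grow (suc d) = ≤-trans (grow d) (f≤f-suc (d + p))

    reflect-< : ∀ {p q} → f p < f q → p < q
    reflect-< fp<fq = ≰⇒> (λ q≤p → <⇒≱ fp<fq (monotone q≤p))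

    squeeze : ∀ {p q r} → p ≤ q → q ≤ r → f p ≡ f r → f q ≡ f p
    squeeze {q = q} p≤q q≤r eq = ≤-antisym (subst (f q ≤_) (sym eq) (monotone q≤r)) (monotone p≤q)

    crossing : ∀ {p j} q → f p ≤ j → f q ≡ suc j →
               ∃[ r ] (p ≤ r × r < q × f r ≡ j × f (suc r) ≡ suc j)
    crossing {p} zero fp≤j eq with reflect-< (subst (f p <_) (sym eq) (s≤s fp≤j))
    ... | ()
    crossing {p} (suc r) fp≤j eq with unit r
    ... | inj₁ stay =
      let r' , p≤r' , r'<r , eq₁ , eq₂ = crossing r fp≤j (trans (sym stay) eq)
      in r' , p≤r' , ≤-trans r'<r (n≤1+n r) , eq₁ , eq₂
    ... | inj₂ step =
      r , ≤-pred (reflect-< (subst (f p <_) (sym eq) (s≤s fp≤j))) , ≤-refl ,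
      suc-injective (trans (sym step) eq) , eq

    crossing-unique : ∀ {q q' j} → f q ≡ j → f (suc q) ≡ suc j → f q' ≡ j → f (suc q') ≡ suc j → q ≡ q'
    crossing-unique {q} {q'} fq fsq fq' fsq' with <-cmp q q'
    ... | tri≈ _ q≡q' _ = q≡q'
    ... | tri< q<q' _ _ = ⊥-elim (1+n≰n (subst₂ _≤_ fsq fq' (monotone q<q')))
    ... | tri> _ _ q'<q = ⊥-elim (1+n≰n (subst₂ _≤_ fsq' fq (monotone q'<q)))

    intermediateValue : f 0 ≡ 0 → ∀ {j} p → j ≤ f p → ∃[ q ] f q ≡ j
    intermediateValue f0 zero j≤f0 = 0 , trans f0 (sym (n≤0⇒n≡0 (subst (_ ≤_) f0 j≤f0)))
    intermediateValue f0 (suc p) j≤f with m≤n⇒m<n∨m≡n j≤f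
    ... | inj₂ j≡f = suc p , sym j≡f
    ... | inj₁ j<f = intermediateValue f0 p (≤-pred (≤-trans j<f (f-suc≤1+f p)))

  inInd-pred : ∀ L {j} → InInd L (suc j) → InInd L j
  inInd-pred (fin n) j<n = ≤-trans (n≤1+n _) j<n
  inInd-pred inf     _   = tt

  inInd-zero : ∀ L → InInd L 0
  inInd-zero (fin n) = z≤n
  inInd-zero inf     = tt

  inInd? : ∀ L j → Dec (InInd L j)
  inInd? (fin n) j = j ≤? n
  inInd? inf     j = yes tt

  Attained : (ℕ → ℕ) → ℕ → Set
  Attained f j = ∃[ p ] f p ≡ j

  record Range (f : ℕ → ℕ) : Set where
    field
      len      : Len
      attained : ∀ j → InInd len j → Attained f j
      bounded  : ∀ p → InInd len (f p)

  module _ {f : ℕ → ℕ} (f0 : f 0 ≡ 0) (unit : UnitStep f) where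
    open UnitStep unit

    boundedRange : ∀ p₀ → (∀ p → f p ≤ f p₀) → Range f
    boundedRange p₀ bound = record
      { len      = fin (f p₀)
      ; attained = λ j j≤ → intermediateValue f0 p₀ j≤
      ; bounded  = bound
      }

    eventuallyConstantRange : ∀ p₀ → (∀ d → f (d + p₀) ≡ f p₀) → Range f
    eventuallyConstantRange p₀ const = boundedRange p₀ bound
      where
      bound : ∀ p → f p ≤ f p₀
      bound p with ≤-total p p₀
      ... | inj₁ p≤p₀ = monotone p≤p₀
      ... | inj₂ p₀≤p = ≤-reflexive (subst (λ q → f q ≡ f p₀) (m∸n+n≡m p₀≤p) (const (p ∸ p₀)))

    classicalRange : EM → Range f
    classicalRange em with decide em (∃[ m ] (Attained f m × ¬ Attained f (suc m)))
    ... | yes (m , (p₀ , fp₀≡m) , ¬next) = boundedRange p₀ bound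
      where
      bound : ∀ p → f p ≤ f p₀
      bound p with f p ≤? m
      ... | yes fp≤m = subst (f p ≤_) (sym fp₀≡m) fp≤m
      ... | no fp≰m  = ⊥-elim (¬next (intermediateValue f0 p (≰⇒> fp≰m)))
    ... | no noBoundary = record { len = inf ; attained = λ j _ → attained j ; bounded = λ _ → tt }
      where
      attained : ∀ j → Attained f j
      attained zero    = 0 , f0
      attained (suc j) = ¬¬-elim em (λ ¬a → noBoundary (j , attained j , ¬a))

module Destuttering {Act : Set} {τ : Act} (B : Automaton Act τ) where
  open import Data.Nat using (zero; suc)
  open Automaton B
  open Sequences

  module Run (u : ℕ → State) (label : ℕ → Act) (J : ℕ → ℕ) (J-zero : J 0 ≡ 0)
           (stepOrStay : ∀ p → (J (suc p) ≡ J p × u (suc p) ≡ u p)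
                             ⊎ (J (suc p) ≡ suc (J p) × Step (u p) (label p) (u (suc p))))
           (range : Range J) where
    open Range range

    J-unit : UnitStep J
    J-unit p with stepOrStay p
    ... | inj₁ (stay , _) = inj₁ stay
    ... | inj₂ (step , _) = inj₂ step

    open UnitStep J-unit

    stutterFrom : ∀ {p} d → J (d + p) ≡ J p → u (d + p) ≡ u p
    stutterFrom zero    _  = refl
    stutterFrom {p} (suc d) eq with stepOrStay (d + p)
    ... | inj₁ (Jstay , ustay) = trans ustay (stutterFrom d (trans (sym Jstay) eq))
    ... | inj₂ (Jstep , _) =
      ⊥-elim (1+n≰n (≤-trans (s≤s (monotone (m≤n+m p d))) (≤-reflexive (trans (sym Jstep) eq))))

    sameState≤ : ∀ {p q} → p ≤ q → J p ≡ J q → u p ≡ u q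
    sameState≤ {p} p≤q eq =
      sym (subst (λ r → J r ≡ J p → u r ≡ u p) (m∸n+n≡m p≤q) (stutterFrom _) (sym eq))

    sameState : ∀ {p q} → J p ≡ J q → u p ≡ u q
    sameState {p} {q} eq with ≤-total p q
    ... | inj₁ p≤q = sameState≤ p≤q eq
    ... | inj₂ q≤p = sym (sameState≤ q≤p (sym eq))

    climb : ∀ j → InInd len (suc j) → ∃[ q ] (J q ≡ j × J (suc q) ≡ suc j)
    climb j j+1∈ =
      let p , Jp≡ = attained (suc j) j+1∈
          q , _ , _ , Jq≡ , Jq+1≡ = crossing p (subst (_≤ j) (sym J-zero) z≤n) Jp≡
      in q , Jq≡ , Jq+1≡

    position : ℕ → ℕ
    position j with inInd? len (suc j) | inInd? len j
    ... | yes j+1∈ | _      = proj₁ (climb j j+1∈)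
    ... | no _     | yes j∈ = proj₁ (attained j j∈)
    ... | no _     | no _   = 0

    position-visits : ∀ j → InInd len j → J (position j) ≡ j
    position-visits j j∈ with inInd? len (suc j) | inInd? len j
    ... | yes j+1∈ | _     = proj₁ (proj₂ (climb j j+1∈))
    ... | no _     | yes _ = proj₂ (attained j _)
    ... | no _     | no j∉ = ⊥-elim (j∉ j∈)

    position-climbs : ∀ j → InInd len (suc j) → J (suc (position j)) ≡ suc j
    position-climbs j j+1∈ with inInd? len (suc j) | inInd? len j
    ... | yes _ | _ = proj₂ (proj₂ (climb j _))
    ... | no j+1∉ | _ = ⊥-elim (j+1∉ j+1∈)

    fragment : ExecFrag B
    fragment = record
      { len  = len
      ; st   = λ j → u (position j)
      ; act  = λ j → label (position j)
      ; step = step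
      }
      where
      step : ∀ j → InInd len (suc j) → Step (u (position j)) (label (position j)) (u (position (suc j)))
      step j j+1∈ with stepOrStay (position j)
      ... | inj₁ (stay , _) = ⊥-elim (1+n≢n (trans (sym (position-climbs j j+1∈))
                                              (trans stay (position-visits j (inInd-pred len j+1∈)))))
      ... | inj₂ (_ , s) = subst (Step _ _)
                                 (sameState (trans (position-climbs j j+1∈) (sym (position-visits (suc j) j+1∈)))) s

    fragment-st : ∀ p → u (position (J p)) ≡ u p
    fragment-st p = sameState (position-visits (J p) (bounded p))

    fragment-act : ∀ p → J (suc p) ≡ suc (J p) → label (position (J p)) ≡ label p
    fragment-act p climbs =
      cong label (crossing-unique (position-visits (J p) (bounded p))
                                  (position-climbs (J p) (subst (InInd len) climbs (bounded (suc p))))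
                                  refl climbs)

module Lockstep {Act : Set} {τ : Act} {A B : Automaton Act τ}
                (b : Automaton.State A → Automaton.State B → Set) (α : Execution A) where
  open import Data.Nat using (zero; suc)
  private
    module B = Automaton B
    module α = Execution α
  open Sequences

  data Move (i : ℕ) (u : B.State) : ℕ → B.State → Set where
    stutter : Move i u i u
    moveA   : α.act i ≡ τ → Move i u (suc i) u
    moveB   : ∀ {u'} → B.Step u τ u' → Move i u i u'
    moveAB  : ∀ {u'} → B.Step u (α.act i) u' → Move i u (suc i) u'

  module _ {i i' : ℕ} {u u' : B.State} where

    bAdvance : Move i u i' u' → ℕ → ℕ
    bAdvance stutter    j = j
    bAdvance (moveA _)  j = j
    bAdvance (moveB _)  j = suc j
    bAdvance (moveAB _) j = suc j

    -- Only meaningful for the moves in which B takes a step.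
    label : Move i u i' u' → Act
    label stutter    = τ
    label (moveA _)  = τ
    label (moveB _)  = τ
    label (moveAB _) = α.act i

    move-index : Move i u i' u' → i' ≡ i ⊎ i' ≡ suc i
    move-index stutter    = inj₁ refl
    move-index (moveA _)  = inj₂ refl
    move-index (moveB _)  = inj₁ refl
    move-index (moveAB _) = inj₂ refl

    move-B : (m : Move i u i' u') → ∀ j →
             (bAdvance m j ≡ j × u' ≡ u) ⊎ (bAdvance m j ≡ suc j × B.Step u (label m) u')
    move-B stutter    j = inj₁ (refl , refl)
    move-B (moveA _)  j = inj₁ (refl , refl)
    move-B (moveB s)  j = inj₂ (refl , s)
    move-B (moveAB s) j = inj₂ (refl , s)

    move-onlyA : ∀ {j} (m : Move i u i' u') → i' ≡ suc i → bAdvance m j ≡ j → α.act i ≡ τ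
    move-onlyA (moveA e)  _ _  = e
    move-onlyA (moveAB _) _ eq = ⊥-elim (1+n≢n eq)

    move-onlyB : ∀ {j} (m : Move i u i' u') → i' ≡ i → bAdvance m j ≡ suc j → label m ≡ τ
    move-onlyB stutter   _ eq = ⊥-elim (1+n≢n (sym eq))
    move-onlyB (moveB _) _ _  = refl

    move-both : ∀ {j} (m : Move i u i' u') → i' ≡ suc i → bAdvance m j ≡ suc j → α.act i ≡ label m
    move-both (moveA _)  _ eq = ⊥-elim (1+n≢n (sym eq))
    move-both (moveAB _) _ _  = refl

  record Path : Set where
    field
      index      : ℕ → ℕ
      state      : ℕ → B.State
      move       : ∀ p → Move (index p) (state p) (index (suc p)) (state (suc p))
      start      : B.Start (state 0)
      related    : ∀ p → b (α.st (index p)) (state p)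
      inIndex    : ∀ p → InInd α.len (index p)
      covers     : ∀ i → InInd α.len i → Attained index i

    bIndex : ℕ → ℕ
    bIndex zero    = 0
    bIndex (suc p) = bAdvance (move p) (bIndex p)

    index-unit : UnitStep index
    index-unit p = move-index (move p)

    bIndex-unit : UnitStep bIndex
    bIndex-unit p with move-B (move p) (bIndex p)
    ... | inj₁ (stay , _) = inj₁ stay
    ... | inj₂ (step , _) = inj₂ step

  module _ (P : Path) (range : Range (Path.bIndex P)) where
    open Path P
    open Range range
    module ι = UnitStep index-unit
    module κ = UnitStep bIndex-unit
    open Destuttering.Run B state (λ p → label (move p)) bIndex refl (λ p → move-B (move p) (bIndex p)) range

    β : Execution B
    β = record { frag = fragment ; start = subst B.Start (sym (fragment-st 0)) start }
    private
      module β = Execution β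

    Visited : ℕ → ℕ → Set
    Visited i j = ∃[ p ] (index p ≡ i × bIndex p ≡ j)

    act-onlyA : ∀ {i j} → Visited i j → Visited (suc i) j → α.act i ≡ τ
    act-onlyA (p , ιp , κp) (p' , ιp' , κp') =
      let q , p≤q , q<p' , ιq , ιq+1 = ι.crossing p' (≤-reflexive ιp) ιp'
          κq   = κ.squeeze p≤q (<⇒≤ q<p') (trans κp (sym κp'))
          κq+1 = κ.squeeze (≤-trans p≤q (n≤1+n q)) q<p' (trans κp (sym κp'))
      in subst (λ k → α.act k ≡ τ) ιq (move-onlyA (move q) (trans ιq+1 (cong suc (sym ιq))) (trans κq+1 (sym κq)))

    act-onlyB : ∀ {i j} → Visited i j → Visited i (suc j) → β.act j ≡ τ
    act-onlyB (p , ιp , κp) (p' , ιp' , κp') =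
      let q , p≤q , q<p' , κq , κq+1 = κ.crossing p' (≤-reflexive κp) κp'
          ιq   = ι.squeeze p≤q (<⇒≤ q<p') (trans ιp (sym ιp'))
          ιq+1 = ι.squeeze (≤-trans p≤q (n≤1+n q)) q<p' (trans ιp (sym ιp'))
          climbs = trans κq+1 (cong suc (sym κq))
      in subst (λ k → β.act k ≡ τ) κq
           (trans (fragment-act q climbs) (move-onlyB (move q) (trans ιq+1 (sym ιq)) climbs))

    -- The path crosses from (i , j) to (i + 1 , j + 1) either diagonally or through (i + 1 , j) or (i , j + 1).
    act-both : ∀ {i j} → Visited i j → Visited (suc i) (suc j) → α.act i ≡ β.act j
    act-both {i} {j} v@(p , ιp , κp) v'@(p' , ιp' , κp')
      with ι.crossing p' (≤-reflexive ιp) ιp'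
    ... | q , p≤q , q<p' , ιq , ιq+1 with bIndex q ≟ j | bIndex-unit q
    ...   | yes κq | inj₂ climbs =
      trans (subst (λ k → α.act k ≡ _) ιq (move-both (move q) (trans ιq+1 (cong suc (sym ιq))) climbs))
            (sym (subst (λ k → β.act k ≡ label (move q)) κq (fragment-act q climbs)))
    ...   | yes κq | inj₁ κstay =
      let w = suc q , ιq+1 , trans κstay κq
      in trans (act-onlyA v w) (sym (act-onlyB w v'))
    ...   | no κq≢j | _ =
      let j≤κq  = subst (_≤ bIndex q) κp (κ.monotone p≤q)
          κq≤j+1 = subst (bIndex q ≤_) κp' (κ.monotone (<⇒≤ q<p'))
          w = q , ιq , ≤-antisym κq≤j+1 (≤∧≢⇒< j≤κq (κq≢j ∘ sym))
      in trans (act-onlyA w v') (sym (act-onlyB v w))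

    corresponds : Corresponds b α β
    corresponds = Visited , inIndices , relates , ordered , leftTotal , rightTotal , act-both , act-onlyA , act-onlyB
      where
      inIndices : ∀ {i j} → Visited i j → InInd α.len i × InInd β.len j
      inIndices (p , refl , refl) = inIndex p , bounded p

      relates : ∀ {i j} → Visited i j → b (α.st i) (β.st j)
      relates (p , refl , refl) = subst (b _) (sym (fragment-st p)) (related p)

      ordered : ∀ {i j i' j'} → Visited i j → Visited i' j' → i < i' → j ≤ j'
      ordered (p , refl , refl) (p' , refl , refl) ιp<ιp' = κ.monotone (<⇒≤ (ι.reflect-< ιp<ιp'))

      leftTotal : ∀ i → InInd α.len i → ∃[ j ] Visited i j
      leftTotal i i∈ = let p , ιp = covers i i∈ in bIndex p , p , ιp , refl

      rightTotal : ∀ j → InInd β.len j → ∃[ i ] Visited i j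
      rightTotal j j∈ = let p , κp = attained j j∈ in index p , p , refl , κp

  correspondingExecution : (P : Path) (range : Range (Path.bIndex P)) →
                           Σ (Execution B) λ β → Execution.len β ≡ Range.len range × Corresponds b α β
  correspondingExecution P range = β P range , refl , corresponds P range

module BackwardSearch {Act : Set} {τ : Act} {A B : Automaton Act τ}
    (b : Automaton.State A → Automaton.State B → Set)
    {S : Set} {_<ˢ_ : S → S → Set} (wf : WellFounded _<ˢ_)
    {nStart : ∀ {s} → Automaton.Start A s → Automaton.State B → S}
    {nStep : ∀ {t a s} → Automaton.Step A t a s → Automaton.State B → S}
    (sim : IsNormedBackwardSim {A = A} {B = B} b S _<ˢ_ nStart nStep)
    (α : Execution A) where
  open import Data.Nat using (zero; suc)
  private
    module B = Automaton B
    module α = Execution α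
  open IsNormedBackwardSim sim
  open Classical using (EM; ∀∃∈⇒∃∈∀)
  open Sequences

  τWithin : (B.State → Set) → B.State → B.State → Set
  τWithin P x y = B.Step x τ y × P y

  descend : (P Q : B.State → Set) (norm : B.State → S) →
            (∀ {u} → P u → Q u ⊎ ∃[ v ] (P v × B.Step v τ u × norm v <ˢ norm u)) →
            ∀ {u} → P u → ∃[ x ] (Q x × P x × Star (τWithin P) x u)
  descend P Q norm back {u} pu = go pu (wf (norm u))
    where
    go : ∀ {u} → P u → Acc _<ˢ_ (norm u) → ∃[ x ] (Q x × P x × Star (τWithin P) x u)
    go {u} pu (acc smaller) with back pu
    ... | inj₁ qu = u , qu , pu , ε
    ... | inj₂ (v , pv , step , v<u) =
      let x , qx , px , chain = go pv (smaller v<u) in x , qx , px , chain ◅◅ ((step , pu) ◅ ε)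

  τChain : ℕ → B.State → B.State → Set
  τChain i = Star (τWithin (b (α.st i)))

  backStart : ∀ {u} → b (α.st 0) u → ∃[ w ] (B.Start w × b (α.st 0) w × τChain 0 w u)
  backStart = descend (b (α.st 0)) B.Start (nStart α.start) (start-cond α.start)

  data Segment (i : ℕ) (v u : B.State) : Set where
    onlyA : α.act i ≡ τ → b (α.st (suc i)) v → τChain (suc i) v u → Segment i v u
    withB : ∀ {x} → B.Step v (α.act i) x → b (α.st (suc i)) x → τChain (suc i) x u → Segment i v u

  backStep : ∀ i → InInd α.len (suc i) → ∀ {u} → b (α.st (suc i)) u → ∃[ v ] (b (α.st i) v × Segment i v u)
  backStep i i+1∈ bu with descend (b (α.st (suc i))) Entry (nStep (α.step i i+1∈))
                                  (λ bu → assocˡ (step-cond (α.step i i+1∈) bu)) bu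
    where
    Entry : B.State → Set
    Entry x = (b (α.st i) x × α.act i ≡ τ) ⊎ ∃[ v ] (b (α.st i) v × B.Step v (α.act i) x)
  ... | x , inj₁ (bx , silent) , bx' , chain = x , bx , onlyA silent bx' chain
  ... | x , inj₂ (v , bv , step) , bx , chain = v , bv , withB step bx chain

  record Viability : Set₁ where
    field
      Viable  : ℕ → B.State → Set
      initial : ∃[ w ] ∃[ v ] (B.Start w × b (α.st 0) w × τChain 0 w v × Viable 0 v)
      extend  : ∀ {i v} → Viable i v → InInd α.len (suc i) → ∃[ u ] (Segment i v u × Viable (suc i) u)

  module Construction (viability : Viability) where
    open Viability viability
    open Lockstep {A = A} {B = B} b α

    record Config : Set where
      constructor config
      field
        index   : ℕ
        inIndex : InInd α.len index
        state   : B.State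
        related : b (α.st index) state
        target  : B.State
        chain   : τChain index state target
        viable  : Viable index target
    open Config

    advance : (c : Config) → Σ Config λ c' → Move (index c) (state c) (index c') (state c')
    advance (config i i∈ u bu w ((step , bu') ◅ chain) vw) = config i i∈ _ bu' w chain vw , moveB step
    advance (config i i∈ u bu u ε vu) with inInd? α.len (suc i)
    ... | no _ = config i i∈ u bu u ε vu , stutter
    ... | yes i+1∈ with extend vu i+1∈
    ...   | u' , onlyA silent bu chain , vu' = config (suc i) i+1∈ u bu u' chain vu' , moveA silent
    ...   | u' , withB step bx chain , vu' = config (suc i) i+1∈ _ bx u' chain vu' , moveAB step

    next : Config → Config
    next c = proj₁ (advance c)

    iterate : Config → ℕ → Config
    iterate c zero    = c
    iterate c (suc p) = next (iterate c p)

    iterate-+ : ∀ c p q → iterate (iterate c p) q ≡ iterate c (q + p)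
    iterate-+ c p zero    = refl
    iterate-+ c p (suc q) = cong next (iterate-+ c p q)

    data Idle : Config → Set where
      idle : ∀ {i i∈ u bu vu} → Idle (config i i∈ u bu u ε vu)

    drain : ∀ c → ∃[ q ] (Idle (iterate c q) × index (iterate c q) ≡ index c)
    drain (config i i∈ u bu w chain vw) = drainChain chain
      where
      drainChain : ∀ {u bu} (chain : τChain i u w) →
                   let c = config i i∈ u bu w chain vw in ∃[ q ] (Idle (iterate c q) × index (iterate c q) ≡ i)
      drainChain ε = 0 , idle , refl
      drainChain {u} {bu} chain@((_ , bu') ◅ rest) =
        let q , idl , same = drainChain {bu = bu'} rest
        in q + 1 , subst (λ c' → Idle c' × index c' ≡ i) (iterate-+ (config i i∈ u bu w chain vw) 1 q) (idl , same)

    idle-progress : ∀ {c} → Idle c → InInd α.len (suc (index c)) → index (next c) ≡ suc (index c)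
    idle-progress {config i i∈ u bu u ε vu} idle i+1∈ with inInd? α.len (suc i)
    ... | no i+1∉ = ⊥-elim (i+1∉ i+1∈)
    ... | yes i+1∈ with extend vu i+1∈
    ...   | _ , onlyA _ _ _ , _ = refl
    ...   | _ , withB _ _ _ , _ = refl

    idle-stuck : ∀ {c} → Idle c → ¬ InInd α.len (suc (index c)) →
                 next c ≡ c × (∀ j → bAdvance (proj₂ (advance c)) j ≡ j)
    idle-stuck {config i i∈ u bu u ε vu} idle i+1∉ with inInd? α.len (suc i)
    ... | no _ = refl , λ _ → refl
    ... | yes i+1∈ = ⊥-elim (i+1∉ i+1∈)

    initialConfig : Config
    initialConfig = let _ , v , _ , bw , chain , vv = initial in config 0 (inInd-zero α.len) _ bw v chain vv

    run : ℕ → Config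
    run = iterate initialConfig

    covers : ∀ i → InInd α.len i → Attained (λ p → index (run p)) i
    covers zero    _    = 0 , refl
    covers (suc i) i+1∈ =
      let p , ιp = covers i (inInd-pred α.len i+1∈)
          q , idl , same = drain (run p)
          atI = trans same ιp
          progress = idle-progress idl (subst (λ k → InInd α.len (suc k)) (sym atI) i+1∈)
      in suc (q + p) , subst (λ c → index (next c) ≡ suc i) (iterate-+ initialConfig p q) (trans progress (cong suc atI))

    path : Path
    path = record
      { index      = λ p → index (run p)
      ; state      = λ p → state (run p)
      ; move       = λ p → proj₂ (advance (run p))
      ; start      = let _ , _ , sw , _ = initial in sw
      ; related    = λ p → related (run p)
      ; inIndex    = λ p → inIndex (run p)
      ; covers     = covers
      }

    Stuck : Config → Set
    Stuck c = next c ≡ c × (∀ j → bAdvance (proj₂ (advance c)) j ≡ j)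

    eventuallyStuck : ∀ {n} → α.len ≡ fin n → ∃[ p₀ ] Stuck (run p₀)
    eventuallyStuck {n} len≡n =
      let p , ιp = covers n (subst (λ L → InInd L n) (sym len≡n) ≤-refl)
          q , idl , same = drain (run p)
          atEnd = trans same ιp
          beyond : ¬ InInd α.len (suc (index (iterate (run p) q)))
          beyond i+1∈ = 1+n≰n (subst (λ L → InInd L (suc n)) len≡n (subst (λ k → InInd α.len (suc k)) atEnd i+1∈))
      in q + p , subst Stuck (iterate-+ initialConfig p q) (idle-stuck idl beyond)

    stuckForever : ∀ {p₀} → Stuck (run p₀) → ∀ d → run (d + p₀) ≡ run p₀
    stuckForever stuck zero    = refl
    stuckForever stuck (suc d) = trans (cong next (stuckForever stuck d)) (proj₁ stuck)

    classicalPathRange : EM → Range (Path.bIndex path)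
    classicalPathRange = classicalRange refl (Path.bIndex-unit path)

    finiteRange : ∀ {n} → α.len ≡ fin n → Range (Path.bIndex path)
    finiteRange len≡n =
      let p₀ , stuck = eventuallyStuck len≡n
      in eventuallyConstantRange refl (Path.bIndex-unit path) p₀ (bIndex-constant stuck)
      where
      open Path path using (bIndex)
      bIndex-constant : ∀ {p₀} → Stuck (run p₀) → ∀ d → bIndex (d + p₀) ≡ bIndex p₀
      bIndex-constant stuck zero = refl
      bIndex-constant {p₀} stuck (suc d) =
        trans (subst (λ c → bAdvance (proj₂ (advance c)) (bIndex (d + p₀)) ≡ bIndex (d + p₀))
                     (sym (stuckForever stuck d)) (proj₂ stuck _))
              (bIndex-constant stuck d)

  data Completable (n : ℕ) : ℕ → B.State → Set where
    done    : ∀ {v} → Completable n n v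
    segment : ∀ {i v u} → Segment i v u → Completable n (suc i) u → Completable n i v

  finiteViability : ∀ {n} → α.len ≡ fin n → Viability
  finiteViability {n} len≡n = record
    { Viable  = Completable n
    ; initial = build n ≤-refl (proj₂ (total (α.st n))) done
    ; extend  = extend
    }
    where
    build : ∀ k → k ≤ n → ∀ {u} → b (α.st k) u → Completable n k u →
            ∃[ w ] ∃[ v ] (B.Start w × b (α.st 0) w × τChain 0 w v × Completable n 0 v)
    build zero    _   bu c = let w , sw , bw , chain = backStart bu in w , _ , sw , bw , chain , c
    build (suc k) k<n bu c =
      let v , bv , sg = backStep k (subst (λ L → InInd L (suc k)) (sym len≡n) k<n) bu
      in build k (≤-trans (n≤1+n k) k<n) bv (segment sg c)

    extend : ∀ {i v} → Completable n i v → InInd α.len (suc i) → ∃[ u ] (Segment i v u × Completable n (suc i) u)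
    extend done           n+1∈ = ⊥-elim (1+n≰n (subst (λ L → InInd L (suc n)) len≡n n+1∈))
    extend (segment sg c) _    = _ , sg , c

  module Infinite (em : EM) (imageFinite : ImageFinite {A = A} {B = B} b) (len≡∞ : α.len ≡ inf) where

    Extension : ℕ → ℕ → B.State → Set
    Extension zero    i v = ⊤
    Extension (suc m) i v = ∃[ u ] (b (α.st (suc i)) u × Segment i v u × Extension m (suc i) u)

    extension-antitone : ∀ {m k i v} → k ≤ m → Extension m i v → Extension k i v
    extension-antitone {k = zero}  _         _                 = tt
    extension-antitone {k = suc k} (s≤s k≤m) (u , bu , sg , e) = u , bu , sg , extension-antitone k≤m e

    backExtension : ∀ m i {u} → b (α.st (m + i)) u → ∃[ v ] (b (α.st i) v × Extension m i v)
    backExtension zero    i bu = _ , bu , tt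
    backExtension (suc m) i {u} bu =
      let w , bw , e  = backExtension m (suc i) (subst (λ k → b (α.st k) u) (sym (+-suc m i)) bu)
          v , bv , sg = backStep i (subst (λ L → InInd L (suc i)) (sym len≡∞) tt) bw
      in v , bv , w , bw , sg , e

    infiniteViability : Viability
    infiniteViability = record
      { Viable  = λ i v → ∀ m → Extension m i v
      ; initial = initial
      ; extend  = extend
      }
      where
      initial : ∃[ w ] ∃[ v ] (B.Start w × b (α.st 0) w × τChain 0 w v × ∀ m → Extension m 0 v)
      initial =
        let l , b⇔∈ = imageFinite (α.st 0)
            deep : ∀ m → ∃[ v ] (v ∈ l × Extension m 0 v)
            deep m = let v , bv , e = backExtension m 0 (proj₂ (total (α.st (m + 0))))
                     in v , Equivalence.to (b⇔∈ v) bv , e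
            v , v∈l , ext = ∀∃∈⇒∃∈∀ em (λ m v → Extension m 0 v) extension-antitone l deep
            w , sw , bw , chain = backStart (Equivalence.from (b⇔∈ v) v∈l)
        in w , v , sw , bw , chain , ext

      extend : ∀ {i v} → (∀ m → Extension m i v) → InInd α.len (suc i) →
               ∃[ u ] (Segment i v u × ∀ m → Extension m (suc i) u)
      extend {i} {v} ext _ =
        let l , b⇔∈ = imageFinite (α.st (suc i))
            deep : ∀ m → ∃[ u ] (u ∈ l × Segment i v u × Extension m (suc i) u)
            deep m = let u , bu , sg , e = ext (suc m) in u , Equivalence.to (b⇔∈ u) bu , sg , e
            u , _ , ext′ = ∀∃∈⇒∃∈∀ em (λ m u → Segment i v u × Extension m (suc i) u)
                                   (λ k≤m (sg , e) → sg , extension-antitone k≤m e) l deep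
        in u , proj₁ (ext′ 0) , λ m → proj₂ (ext′ m)

-- Opened only here, since Level's suc and zero would clash with ℕ's in the modules above.
open Level using (suc; zero)

theorem5p3 : {Act : Set} {τ : Act} (A B : Automaton Act τ)
    (b : Automaton.State A → Automaton.State B → Set)
    (S : Set) (_<ˢ_ : S → S → Set) → WellFounded _<ˢ_ → Transitive _<ˢ_ →
    (nStart : ∀ {s} → Automaton.Start A s → Automaton.State B → S)
    (nStep : ∀ {t a s} → Automaton.Step A t a s → Automaton.State B → S) →
    IsNormedBackwardSim {A = A} {B = B} b S _<ˢ_ nStart nStep →
    ((α : Execution A) → IsFinite A α →
      Σ (Execution B) λ α' → IsFinite B α' × Corresponds {A = A} {B = B} b α α')
    × (ExcludedMiddle (suc zero) → ImageFinite {A = A} {B = B} b →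
      (α : Execution A) → Σ (Execution B) λ α' → Corresponds {A = A} {B = B} b α α')
theorem5p3 A B b _ _ wf _ _ _ sim = finite , infinite
  where
  finite : (α : Execution A) → IsFinite A α →
           Σ (Execution B) λ α' → IsFinite B α' × Corresponds {A = A} {B = B} b α α'
  finite α (n , len≡n) =
    let open BackwardSearch b wf sim α
        open Construction (finiteViability len≡n)
        β , len≡ , corr = Lockstep.correspondingExecution b α path (finiteRange len≡n)
    in β , (_ , len≡) , corr

  infinite : ExcludedMiddle (suc zero) → ImageFinite {A = A} {B = B} b →
             (α : Execution A) → Σ (Execution B) λ α' → Corresponds {A = A} {B = B} b α α'
  infinite em imageFinite α = byLength (Execution.len α) refl
    where
    byLength : ∀ L → Execution.len α ≡ L → Σ (Execution B) λ α' → Corresponds {A = A} {B = B} b α α'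
    byLength (fin n) len≡n = let β , _ , corr = finite α (n , len≡n) in β , corr
    byLength inf     len≡∞ =
      let open BackwardSearch b wf sim α
          open Construction (Infinite.infiniteViability em imageFinite len≡∞)
          β , _ , corr = Lockstep.correspondingExecution b α path (classicalPathRange em)
      in β , corr
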